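{- Let $G$ be a graph, let $r>0$, and let $\vec H$ be an $r$-transitive fraternal augmentation of $G$ with $\Delta^-(\vec H)\le d$. Then $\mathrm{wcol}_r(G)\le 2(d+1)^2$.
   Context: Graphs are finite and simple. An orientation $\vec G$ of $G$ is a directed graph on $V(G)$ containing, for each edge $\{u,v\}\in E(G)$, exactly one of the arcs $(u,v),(v,u)$. $\Delta^-(\vec H)$ is the maximum in-degree of $\vec H$. For a directed graph $\vec G$, a tight $1$-transitive fraternal augmentation of $\vec G$ is a directed graph $\vec H$ on the same vertex set such that for all distinct $u,v,w$: if $(u,v)\in E(\vec G)$ then $(u,v)\in E(\vec H)$; if $(u,w),(w,v)\in E(\vec G)$ then $(u,v)\in E(\vec H)$; if $(u,w),(v,w)\in E(\vec G)$ then $(u,v)$ or $(v,u)$ is an arc of $\vec H$; and for every $(u,v)\in E(\vec H)$, either $(u,v)\in E(\vec G)$ or there is $w$ with $(u,w),(w,v)\in E(\vec G)$ or $(u,w),(v,w)\in E(\vec G)$. Write $\mathrm{aug}(\vec G,1)$ for any such augmentation and $\mathrm{aug}(\vec G,r):=\mathrm{aug}(\mathrm{aug}(\vec G,r-1),1)$ for $r>1$. An $r$-transitive fraternal augmentation of an undirected graph $G$ is some $\mathrm{aug}(\vec G,r)$ for some orientation $\vec G$ of $G$. For a linear order $<$ of $V(G)$ and $k\in\mathbb N$, $u$ is weakly $k$-accessible from $v$ if $u<v$ and there is a $u$–$v$ path of length at most $k$ all of whose vertices $w$ satisfy $u\le w$. $\mathrm{wreach}_k[G,<,v]$ is the set of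 vertices weakly $k$-accessible from $v$ together with $v$. The weak $k$-colouring number is $\mathrm{wcol}_k(G)=\min_{<}\max_{v\in V(G)}|\mathrm{wreach}_k[G,<,v]|$, the minimum over all linear orders of $V(G)$. -}

module Defs where

open import Data.Nat using (ℕ; zero; suc; _≤_)
open import Data.Fin using (Fin) renaming (_<_ to _<ᶠ_; _≤_ to _≤ᶠ_)
open import Data.List using (List; []; _∷_; length; head; last)
open import Data.List.Relation.Unary.All using (All)
open import Data.List.Relation.Unary.Linked using (Linked)
open import Data.List.Relation.Unary.Unique.Propositional using (Unique)
open import Data.List.Membership.Propositional using (_∈_)
open import Data.Maybe using (just)
open import Data.Product using (Σ; ∃; _×_; _,_)
open import Data.Sum using (_⊎_)
open import Data.Empty using (⊥)
open import Relation.Nullary using (¬_)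
open import Relation.Binary.PropositionalEquality using (_≡_; _≢_)
open import Function.Bundles using (_↔_; Inverse)

AtMost : {A : Set} → ℕ → (A → Set) → Set
AtMost {A} k P = Σ (List A) λ xs → (length xs ≤ k) × (∀ x → P x → x ∈ xs)

record Graph (n : ℕ) : Set₁ where
  field
    E     : Fin n → Fin n → Set
    sym   : ∀ {u v} → E u v → E v u
    irrefl : ∀ {u} → ¬ E u u
open Graph public

record Digraph (n : ℕ) : Set₁ where
  field
    Arc    : Fin n → Fin n → Set
    loopless : ∀ {u} → ¬ Arc u u
open Digraph public

IsOrientation : ∀ {n} → Graph n → Digraph n → Set
IsOrientation {n} G O =
  (∀ (u v : Fin n) → E G u v → (Arc O u v ⊎ Arc O v u)) ×
  (∀ (u v : Fin n) → E G u v → ¬ (Arc O u v × Arc O v u)) ×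
  (∀ (u v : Fin n) → Arc O u v → E G u v)

MaxInDegLE : ∀ {n} → Digraph n → ℕ → Set
MaxInDegLE {n} H d = ∀ (v : Fin n) → AtMost d (λ u → Arc H u v)

IsAug1 : ∀ {n} → Digraph n → Digraph n → Set
IsAug1 {n} G H =
  (∀ (u v : Fin n) → Arc G u v → Arc H u v) ×
  (∀ (u v w : Fin n) → u ≢ v → v ≢ w → u ≢ w →
     Arc G u w → Arc G w v → Arc H u v) ×
  (∀ (u v w : Fin n) → u ≢ v → v ≢ w → u ≢ w →
     Arc G u w → Arc G v w → (Arc H u v ⊎ Arc H v u)) ×
  (∀ (u v : Fin n) → Arc H u v →
     Arc G u v ⊎
     (Σ (Fin n) λ w → u ≢ w × v ≢ w × Arc G u w × Arc G w v) ⊎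
     (Σ (Fin n) λ w → u ≢ w × v ≢ w × Arc G u w × Arc G v w))

data Aug {n : ℕ} (G : Digraph n) : ℕ → Digraph n → Set₁ where
  one  : ∀ {H} → IsAug1 G H → Aug G 1 H
  step : ∀ {r H' H} → Aug G r H' → IsAug1 H' H → Aug G (suc r) H

IsTFAug : ∀ {n} → ℕ → Graph n → Digraph n → Set₁
IsTFAug r G H = Σ (Digraph _) λ O → IsOrientation G O × Aug O r H

LinOrder : ℕ → Set
LinOrder n = Fin n ↔ Fin n

module _ {n : ℕ} (ord : LinOrder n) where
  pos : Fin n → Fin n
  pos = Inverse.to ord

  _≺_ : Fin n → Fin n → Set
  u ≺ v = pos u <ᶠ pos v

  _≼_ : Fin n → Fin n → Set
  u ≼ v = pos u ≤ᶠ pos v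

-- xs is a path in G from u to v (vertex list, consecutive vertices adjacent,
-- all vertices distinct).  Its length is length xs - 1.
IsPath : ∀ {n} → Graph n → Fin n → Fin n → List (Fin n) → Set
IsPath G u v xs =
  (head xs ≡ just u) × (last xs ≡ just v) × Linked (E G) xs × Unique xs

WeaklyAcc : ∀ {n} → Graph n → LinOrder n → ℕ → Fin n → Fin n → Set
WeaklyAcc G ord k u v =
  _≺_ ord u v ×
  (Σ (List _) λ xs → IsPath G u v xs × (length xs ≤ suc k) × All (λ w → _≼_ ord u w) xs)

WReach : ∀ {n} → Graph n → LinOrder n → ℕ → Fin n → Fin n → Set
WReach G ord k v u = (u ≡ v) ⊎ WeaklyAcc G ord k u v

WcolLE : ∀ {n} → Graph n → ℕ → ℕ → Set
WcolLE {n} G k m = Σ (LinOrder n) λ ord → ∀ (v : Fin n) → AtMost m (WReach G ord k v)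

module Submission where

-- If H = aug(D, r+1) and W is a walk of length at
--    most r+1 in the underlying graph of D, then some vertex z of W lies in
--    the closed in-neighbourhoods N⁻_H[x] and N⁻_H[y] of both ends x, y of W.
--    One augmentation step shortens a walk by one unless it has the form
--    x ← z → y; the steps of aug(D, r+1) are peeled off from the front.
-- 2. Degenerate orders.  A digraph of maximum in-degree ≤ d has a linear
--    order in which every vertex has at most d out-neighbours below it:
--    double counting arcs shows that every non-empty vertex set contains a
--    vertex with at most d out-neighbours inside it; remove such vertices
--    greedily and rank each one above all vertices remaining at its removal.
-- 3. Take the order of 2. for H.  If u ∈ wreach_r[G,<,v], then 1. applied to
--    the witnessing path, which avoids the vertices below u, yields z ≥ u
--    with z ∈ N⁻_H[v] and z ∈ N⁻_H[u].  So wreach_r[G,<,v] is covered by the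
--    lists {z} ∪ {u < z : z → u in H} for z ∈ N⁻_H[v]: d+1 lists, each of
--    size at most d+1.

open import Defs hiding (sym)
open import Data.Nat using (ℕ; zero; suc; _+_; _*_; _^_; _≤_; _<_; z≤n; s≤s; s≤s⁻¹; _∸_; _≤?_)
open import Data.Nat.Properties
  using (≤-refl; ≤-trans; ≤-reflexive; <-irrefl; n≤1+n; n<1+n; m≤m+n; +-mono-≤; *-identityʳ;
         *-monoˡ-≤; *-monoʳ-<; ≰⇒>; ∸-cancelʳ-<; +-commutativeSemigroup; module ≤-Reasoning)
open import Algebra.Properties.CommutativeSemigroup +-commutativeSemigroup using (x∙yz≈y∙xz)
open import Data.Nat.ListAction using (sum)
open import Data.Fin as Fin using (Fin; toℕ; _≟_; cast; opposite)
open import Data.Fin.Properties using (≤∧≢⇒<; toℕ-cast; opposite-prop; opposite-involutive; cast-involutive)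
open import Data.Fin.Permutation using (↔⇒≡)
open import Data.List using (List; []; _∷_; length; map; filter; concatMap; lookup; last; allFin)
open import Data.List.Properties using (length-++; filter-notAll)
open import Data.List.Relation.Unary.All as All using (All; []; _∷_)
open import Data.List.Relation.Unary.All.Properties using (¬Any⇒All¬)
open import Data.List.Relation.Unary.Any as Any using (here; there; index; any?)
open import Data.List.Relation.Unary.Any.Properties using (lookup-index)
open import Data.List.Relation.Unary.Linked as Linked using (Linked; _∷_)
open import Data.List.Relation.Unary.AllPairs using ([]; _∷_)
open import Data.List.Relation.Unary.Unique.Propositional using (Unique)
open import Data.List.Relation.Unary.Unique.Propositional.Properties using (filter⁺; allFin⁺)
open import Data.List.Membership.Propositional using (_∈_; find; lose)
open import Data.List.Membership.Propositional.Properties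
  using (∈-filter⁺; ∈-filter⁻; ∈-concatMap⁺; ∈-lookup; ∈-allFin)
import Data.List.Membership.DecPropositional as DecMembership
open import Data.Maybe using (just)
open import Data.Maybe.Properties using (just-injective)
open import Data.Product using (Σ; _×_; _,_; proj₁; proj₂)
open import Data.Sum using (_⊎_; inj₁; inj₂)
open import Data.Unit using (⊤; tt)
open import Data.Empty using (⊥-elim)
open import Function using (_∘_)
open import Function.Bundles using (Injection; mk↔ₛ′)
open import Function.Properties.Inverse using (↔⇒↣)
open import Relation.Nullary using (Dec; yes; no; ¬?)
open import Relation.Binary.Definitions using (DecidableEquality)
open import Relation.Binary.PropositionalEquality using (_≡_; _≢_; refl; sym; trans; cong)

Adj : ∀ {n} → Digraph n → Fin n → Fin n → Set
Adj D u v = Arc D u v ⊎ Arc D v u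

InClosedNbhd : ∀ {n} → Digraph n → Fin n → Fin n → Set
InClosedNbhd H z x = z ≡ x ⊎ Arc H z x

arc⇒≢ : ∀ {n} (D : Digraph n) {u v} → Arc D u v → u ≢ v
arc⇒≢ D a refl = loopless D a

data Walk {n : ℕ} (R : Fin n → Fin n → Set) (P : Fin n → Set) : Fin n → Fin n → ℕ → Set where
  nil  : ∀ {x} → P x → Walk R P x x 0
  cons : ∀ {x y z k} → P x → R x y → Walk R P y z k → Walk R P x z (suc k)

map-walk : ∀ {n} {R S : Fin n → Fin n → Set} {P x y k} →
           (∀ {a b} → R a b → S a b) → Walk R P x y k → Walk S P x y k
map-walk f (nil p)      = nil p
map-walk f (cons p e w) = cons p (f e) (map-walk f w)

list⇒walk : ∀ {n} {R : Fin n → Fin n → Set} {P : Fin n → Set} x ys {y} →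
            last (x ∷ ys) ≡ just y → Linked R (x ∷ ys) → All P (x ∷ ys) →
            Walk R P x y (length ys)
list⇒walk x []       ends _          (px ∷ []) with just-injective ends
... | refl = nil px
list⇒walk x (z ∷ zs) ends (e ∷ lnk) (px ∷ ps) = cons px e (list⇒walk z zs ends lnk ps)

aug-keeps-arcs : ∀ {n} {D H : Digraph n} {r u v} → Aug D r H → Arc D u v → Arc H u v
aug-keeps-arcs (one i)    a = proj₁ i _ _ a
aug-keeps-arcs (step g i) a = proj₁ i _ _ (aug-keeps-arcs g a)

aug-uncons : ∀ {n} {D H : Digraph n} {r} → Aug D (suc (suc r)) H →
             Σ (Digraph n) λ D₁ → IsAug1 D D₁ × Aug D₁ (suc r) H
aug-uncons {r = zero}  (step {H' = D₁} (one i₁) i) = D₁ , i₁ , one i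
aug-uncons {r = zero}  (step (step () _) _)
aug-uncons {r = suc r} (step a i) with aug-uncons a
... | D₁ , i₁ , a₁ = D₁ , i₁ , step a₁ i

module OneStep {n} {D D₁ : Digraph n} (aug : IsAug1 D D₁) where

  keep : ∀ {u v} → Arc D u v → Arc D₁ u v
  keep = proj₁ aug _ _

  lift : ∀ {P x y k} → Walk (Adj D) P x y k → Walk (Adj D₁) P x y k
  lift = map-walk λ { (inj₁ a) → inj₁ (keep a) ; (inj₂ a) → inj₂ (keep a) }

  -- A directed step x → w followed by any step w ∼ y between distinct ends
  -- is bridged in D₁, by transitivity or by fraternity.
  bridge : ∀ {x w y} → x ≢ y → Arc D x w → Adj D w y → Adj D₁ x y
  bridge {x} {w} {y} x≢y a (inj₁ a′) =
    inj₁ (proj₁ (proj₂ aug) x y w x≢y (arc⇒≢ D a′ ∘ sym) (arc⇒≢ D a) a a′)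
  bridge {x} {w} {y} x≢y a (inj₂ a′) =
    proj₁ (proj₂ (proj₂ aug)) x y w x≢y (arc⇒≢ D a′) (arc⇒≢ D a) a a′

  two-steps : ∀ {x w y} → x ≢ y → Adj D x w → Adj D w y →
              Adj D₁ x y ⊎ (Arc D w x × Arc D w y)
  two-steps x≢y (inj₁ a) e        = inj₁ (bridge x≢y a e)
  two-steps x≢y (inj₂ a) (inj₂ a′) with bridge (x≢y ∘ sym) a′ (inj₁ a)
  ... | inj₁ b = inj₁ (inj₂ b)
  ... | inj₂ b = inj₁ (inj₁ b)
  two-steps x≢y (inj₂ a) (inj₁ a′) = inj₂ (a , a′)

  Shortened : (Fin n → Set) → Fin n → Fin n → ℕ → Set
  Shortened P x y m =
    (Σ ℕ λ k → k ≤ suc m × Walk (Adj D₁) P x y k) ⊎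
    (Σ (Fin n) λ z → P z × Arc D z x × Arc D z y)

  -- A walk x ← w → x′ ⋯ y: either it stops at x′, or w → x′ ∼ x₃ is bridged.
  shorten-fork : ∀ {P x w x′ y m} → P x → P w → Arc D w x → Arc D w x′ →
                 Walk (Adj D) P x′ y m → Shortened P x y m
  shorten-fork px pw a a′ (nil _) = inj₂ (_ , pw , a , a′)
  shorten-fork {w = w} px pw a a′ (cons {y = x₃} _ e rest) with w ≟ x₃
  ... | yes refl = inj₁ (_ , n≤1+n _ , cons px (inj₂ (keep a)) (lift rest))
  ... | no w≢x₃  = inj₁ (_ , ≤-refl , cons px (inj₂ (keep a)) (cons pw (bridge w≢x₃ a′ e) (lift rest)))

  shorten : ∀ {P x y m} → Walk (Adj D) P x y (suc (suc m)) → Shortened P x y m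
  shorten (cons {x = x₀} p₀ e₀₁ (cons {y = x₂} p₁ e₁₂ rest)) with x₀ ≟ x₂
  ... | yes refl = inj₁ (_ , n≤1+n _ , lift rest)
  ... | no x₀≢x₂ with two-steps x₀≢x₂ e₀₁ e₁₂
  ...   | inj₁ e₀₂         = inj₁ (_ , ≤-refl , cons p₀ e₀₂ (lift rest))
  ...   | inj₂ (a₁₀ , a₁₂) = shorten-fork p₀ p₁ a₁₀ a₁₂ rest

collapse : ∀ {n} r {D H : Digraph n} {P : Fin n → Set} {x y k} →
           Aug D (suc r) H → k ≤ suc r → Walk (Adj D) P x y k →
           Σ (Fin n) λ z → P z × InClosedNbhd H z x × InClosedNbhd H z y
collapse r a _ (nil p)                    = _ , p , inj₁ refl , inj₁ refl
collapse r a _ (cons p (inj₁ e) (nil _))  = _ , p , inj₁ refl , inj₂ (aug-keeps-arcs a e)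
collapse r a _ (cons _ (inj₂ e) (nil p))  = _ , p , inj₂ (aug-keeps-arcs a e) , inj₁ refl
collapse zero    a (s≤s ()) (cons _ _ (cons _ _ _))
collapse (suc r) {D} a (s≤s (s≤s k≤r)) w@(cons _ _ (cons _ _ _)) with aug-uncons a
... | D₁ , aug₁ , a₁ with OneStep.shorten {D = D} {D₁} aug₁ w
...   | inj₁ (k , k≤ , w₁)         = collapse r a₁ (≤-trans k≤ (s≤s k≤r)) w₁
...   | inj₂ (z , pz , a-zx , a-zy) = z , pz , inj₂ (aug-keeps-arcs a a-zx) , inj₂ (aug-keeps-arcs a a-zy)

module Removal {A : Set} (_≟ᴬ_ : DecidableEquality A) where

  _∖_ : List A → A → List A
  xs ∖ x = filter (λ y → ¬? (y ≟ᴬ x)) xs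

  ∖-length : ∀ {x xs} → x ∈ xs → suc (length (xs ∖ x)) ≤ length xs
  ∖-length {x} {xs} x∈xs = filter-notAll _ xs (Any.map (λ x≡y y≢x → y≢x (sym x≡y)) x∈xs)

  ∈-∖⁺ : ∀ {x y xs} → y ∈ xs → y ≢ x → y ∈ xs ∖ x
  ∈-∖⁺ {x} = ∈-filter⁺ (λ y → ¬? (y ≟ᴬ x))

  ∈-∖⁻ : ∀ {x y xs} → y ∈ xs ∖ x → y ∈ xs × y ≢ x
  ∈-∖⁻ {x} = ∈-filter⁻ (λ y → ¬? (y ≟ᴬ x))

  ∖-unique : ∀ {x xs} → Unique xs → Unique (xs ∖ x)
  ∖-unique {x} = filter⁺ (λ y → ¬? (y ≟ᴬ x))

  unique-⊆⇒length-≤ : ∀ {xs ys} → Unique xs → (∀ {y} → y ∈ xs → y ∈ ys) → length xs ≤ length ys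
  unique-⊆⇒length-≤ [] _ = z≤n
  unique-⊆⇒length-≤ {x ∷ xs} {ys} (x∉xs ∷ uniq) xs⊆ys =
    ≤-trans (s≤s (unique-⊆⇒length-≤ uniq into-rest)) (∖-length (xs⊆ys (here refl)))
    where
    into-rest : ∀ {y} → y ∈ xs → y ∈ ys ∖ x
    into-rest y∈xs = ∈-∖⁺ (xs⊆ys (there y∈xs)) (All.lookup x∉xs y∈xs ∘ sym)

sum-map-≤ : ∀ {A : Set} (f : A → ℕ) {m} xs → (∀ x → f x ≤ m) → sum (map f xs) ≤ length xs * m
sum-map-≤ f []       _  = z≤n
sum-map-≤ f (x ∷ xs) le = +-mono-≤ (le x) (sum-map-≤ f xs le)

sum-map-≥ : ∀ {A : Set} (f : A → ℕ) {m xs} → All (λ x → m ≤ f x) xs → length xs * m ≤ sum (map f xs)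
sum-map-≥ f []       = z≤n
sum-map-≥ f (p ∷ ps) = +-mono-≤ p (sum-map-≥ f ps)

+-shift : ∀ c r {s t} → s ≡ r + t → c + s ≡ r + (c + t)
+-shift c r {t = t} s≡r+t = trans (cong (c +_) s≡r+t) (x∙yz≈y∙xz c r t)

module DoubleCounting {A B : Set} {R : A → B → Set} (R? : ∀ a b → Dec (R a b)) where

  count-from : A → List B → ℕ
  count-from a ys = length (filter (R? a) ys)

  count-to : List A → B → ℕ
  count-to xs b = length (filter (λ a → R? a b) xs)

  count-to-∷ : ∀ x xs ys → sum (map (count-to (x ∷ xs)) ys) ≡ count-from x ys + sum (map (count-to xs) ys)
  count-to-∷ x xs []       = refl
  count-to-∷ x xs (y ∷ ys) with R? x y
  ... | yes _ = cong suc (+-shift (count-to xs y) (count-from x ys) (count-to-∷ x xs ys))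
  ... | no _  = +-shift (count-to xs y) (count-from x ys) (count-to-∷ x xs ys)

  count-swap : ∀ xs ys → sum (map (λ a → count-from a ys) xs) ≡ sum (map (count-to xs) ys)
  count-swap []       []       = refl
  count-swap []       (y ∷ ys) = count-swap [] ys
  count-swap (x ∷ xs) ys       = trans (cong (count-from x ys +_) (count-swap xs ys)) (sym (count-to-∷ x xs ys))

≼∧≢⇒≺ : ∀ {n} (ord : LinOrder n) {u z} → _≼_ ord u z → u ≢ z → _≺_ ord u z
≼∧≢⇒≺ ord u≼z u≢z = ≤∧≢⇒< u≼z (u≢z ∘ Injection.injective (↔⇒↣ ord))

index-lookup : ∀ {A : Set} {xs : List A} → Unique xs → ∀ i (p : lookup xs i ∈ xs) → index p ≡ i
index-lookup (x∉xs ∷ _)    Fin.zero    (here _)  = refl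
index-lookup (x∉xs ∷ _)    Fin.zero    (there p) = ⊥-elim (All.lookup x∉xs p refl)
index-lookup (x∉xs ∷ _)    (Fin.suc i) (here e)  = ⊥-elim (All.lookup x∉xs (∈-lookup i) (sym e))
index-lookup (_    ∷ uniq) (Fin.suc i) (there p) = cong Fin.suc (index-lookup uniq i p)

-- A duplicate-free enumeration rs of Fin n induces the linear order in
-- which earlier entries of rs are larger.
module ReverseEnumeration {n} (rs : List (Fin n)) (uniq : Unique rs) (∈rs : ∀ x → x ∈ rs) where

  idx : Fin n → Fin (length rs)
  idx x = index (∈rs x)

  lookup-idx : ∀ x → lookup rs (idx x) ≡ x
  lookup-idx x = sym (lookup-index (∈rs x))

  n≡length : n ≡ length rs
  n≡length = ↔⇒≡ (mk↔ₛ′ idx (lookup rs) (λ i → index-lookup uniq i (∈rs (lookup rs i))) lookup-idx)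

  rank : Fin n → Fin n
  rank x = opposite (cast (sym n≡length) (idx x))

  unrank : Fin n → Fin n
  unrank i = lookup rs (cast n≡length (opposite i))

  order : LinOrder n
  order = mk↔ₛ′ rank unrank rank-unrank unrank-rank
    where
    rank-unrank : ∀ i → rank (unrank i) ≡ i
    rank-unrank i rewrite index-lookup uniq (cast n≡length (opposite i)) (∈rs (unrank i))
                        | cast-involutive (sym n≡length) n≡length (opposite i) = opposite-involutive i
    unrank-rank : ∀ x → unrank (rank x) ≡ x
    unrank-rank x rewrite opposite-involutive (cast (sym n≡length) (idx x))
                        | cast-involutive n≡length (sym n≡length) (idx x) = lookup-idx x

  toℕ-rank : ∀ x → toℕ (rank x) ≡ n ∸ suc (toℕ (idx x))
  toℕ-rank x rewrite opposite-prop (cast (sym n≡length) (idx x)) | toℕ-cast (sym n≡length) (idx x) = refl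

  ≺⇒later : ∀ {u z} → _≺_ order u z → toℕ (idx z) < toℕ (idx u)
  ≺⇒later {u} {z} u≺z = s≤s⁻¹ (∸-cancelʳ-< {o = n} (by-rank u≺z))
    where
    by-rank : toℕ (rank u) < toℕ (rank z) → n ∸ suc (toℕ (idx u)) < n ∸ suc (toℕ (idx z))
    by-rank lt rewrite toℕ-rank u | toℕ-rank z = lt

-- Greedy elimination for a digraph on Fin n presented by lists L u ⊇ N⁻(u)
-- of length at most d.
module Elimination {n d : ℕ} (L : Fin n → List (Fin n)) (L≤d : ∀ u → length (L u) ≤ d) where

  open Removal (_≟_ {n})
  open DecMembership (_≟_ {n}) using (_∈?_)
  open DoubleCounting (λ z u → z ∈? L u) using (count-from; count-to; count-swap)

  -- Every duplicate-free non-empty S contains a vertex z listed in L u for at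
  -- most d vertices u ∈ S: the |S| numbers |{u ∈ S : z ∈ L u}| (z ∈ S) sum up
  -- to Σ_{u ∈ S} |{z ∈ S : z ∈ L u}| ≤ |S|·d.
  sparse-vertex : ∀ s S → Unique (s ∷ S) → Σ (Fin n) λ z → z ∈ s ∷ S × count-from z (s ∷ S) ≤ d
  sparse-vertex s S uniq with any? (λ z → count-from z (s ∷ S) ≤? d) (s ∷ S)
  ... | yes found = find found
  ... | no none   = ⊥-elim (<-irrefl refl (begin-strict
    length S′ * d                          <⟨ *-monoʳ-< (length S′) (n<1+n d) ⟩
    length S′ * suc d                      ≤⟨ sum-map-≥ (λ z → count-from z S′) (All.map ≰⇒> (¬Any⇒All¬ S′ none)) ⟩
    sum (map (λ z → count-from z S′) S′)   ≡⟨ count-swap S′ S′ ⟩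
    sum (map (count-to S′) S′)             ≤⟨ sum-map-≤ (count-to S′) S′ listed≤d ⟩
    length S′ * d                          ∎))
    where
    open ≤-Reasoning
    S′ = s ∷ S
    -- the vertices of S′ listed in L u are distinct members of L u
    listed≤d : ∀ u → count-to S′ u ≤ d
    listed≤d u = ≤-trans (unique-⊆⇒length-≤ (filter⁺ (_∈? L u) uniq) (proj₂ ∘ ∈-filter⁻ (_∈? L u))) (L≤d u)

  Sparse : List (Fin n) → Set
  Sparse []       = ⊤
  Sparse (z ∷ rs) = AtMost d (λ u → u ∈ rs × z ∈ L u) × Sparse rs

  record Arrangement (S : List (Fin n)) : Set where
    field
      seq      : List (Fin n)
      unique   : Unique seq
      complete : ∀ {x} → x ∈ S → x ∈ seq
      sound    : ∀ {x} → x ∈ seq → x ∈ S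
      sparse   : Sparse seq

  -- Greedy elimination: put a sparse vertex z first and arrange S ∖ z
  -- recursively (k bounds the length of S).
  eliminate : ∀ k S → length S ≤ k → Unique S → Arrangement S
  eliminate _ [] _ _ = record { seq = [] ; unique = [] ; complete = λ () ; sound = λ () ; sparse = tt }
  eliminate zero (s ∷ S) () _
  eliminate (suc k) (s ∷ S) (s≤s |S|≤k) uniq = record
    { seq      = z ∷ seq
    ; unique   = All.tabulate (λ x∈ x≡z → proj₂ (∈rest x∈) (sym x≡z)) ∷ unique
    ; complete = complete′
    ; sound    = λ { (here refl) → z∈S ; (there x∈) → proj₁ (∈rest x∈) }
    ; sparse   = (filter (λ u → z ∈? L u) (s ∷ S) , few ,
                  λ u (u∈ , zL) → ∈-filter⁺ (λ u → z ∈? L u) (proj₁ (∈rest u∈)) zL) , sparse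
    }
    where
    chosen = sparse-vertex s S uniq
    z      = proj₁ chosen
    z∈S    = proj₁ (proj₂ chosen)
    few    = proj₂ (proj₂ chosen)
    rest : Arrangement ((s ∷ S) ∖ z)
    rest = eliminate k ((s ∷ S) ∖ z) (s≤s⁻¹ (≤-trans (∖-length z∈S) (s≤s |S|≤k))) (∖-unique uniq)
    open Arrangement rest
    ∈rest : ∀ {x} → x ∈ seq → x ∈ s ∷ S × x ≢ z
    ∈rest = ∈-∖⁻ {xs = s ∷ S} ∘ sound
    complete′ : ∀ {x} → x ∈ s ∷ S → x ∈ z ∷ seq
    complete′ {x} x∈ with x ≟ z
    ... | yes x≡z = here x≡z
    ... | no x≢z  = there (complete (∈-∖⁺ x∈ x≢z))

  sparse-later : ∀ {rs} → Sparse rs → ∀ {z} (z∈ : z ∈ rs) →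
                 AtMost d (λ u → Σ (u ∈ rs) λ u∈ → toℕ (index z∈) < toℕ (index u∈) × z ∈ L u)
  sparse-later ((B , B≤d , ∈B) , _) (here refl) =
    B , B≤d , λ { u (there u∈ , _ , zL) → ∈B u (u∈ , zL) }
  sparse-later (_ , sp) (there z∈) with sparse-later sp z∈
  ... | B , B≤d , ∈B = B , B≤d , λ { u (there u∈ , s≤s lt , zL) → ∈B u (u∈ , lt , zL) }

degenerate-order : ∀ {n} (D : Digraph n) d → MaxInDegLE D d →
                   Σ (LinOrder n) λ ord → ∀ z → AtMost d (λ u → _≺_ ord u z × Arc D z u)
degenerate-order {n} D d indeg = order , few-below
  where
  L : Fin n → List (Fin n)
  L u = proj₁ (indeg u)
  open Elimination L (proj₁ ∘ proj₂ ∘ indeg)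
  arrangement = eliminate (length (allFin n)) (allFin n) ≤-refl (allFin⁺ n)
  open Arrangement arrangement
  ∈seq : ∀ x → x ∈ seq
  ∈seq x = complete (∈-allFin x)
  open ReverseEnumeration seq unique ∈seq
  few-below : ∀ z → AtMost d (λ u → _≺_ order u z × Arc D z u)
  few-below z with sparse-later sparse (∈seq z)
  ... | B , B≤d , ∈B = B , B≤d , λ u (u≺z , a) → ∈B u (∈seq u , ≺⇒later u≺z , proj₂ (proj₂ (indeg u)) z a)

length-concatMap-≤ : ∀ {A B : Set} (f : A → List B) {m} xs → (∀ x → length (f x) ≤ m) →
                     length (concatMap f xs) ≤ length xs * m
length-concatMap-≤ f []       _  = z≤n
length-concatMap-≤ f (x ∷ xs) le =
  ≤-trans (≤-reflexive (length-++ (f x))) (+-mono-≤ (le x) (length-concatMap-≤ f xs le))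

square≤2square : ∀ m → m * m ≤ 2 * m ^ 2
square≤2square m = ≤-trans (≤-reflexive (cong (m *_) (sym (*-identityʳ m)))) (m≤m+n (m ^ 2) _)

-- The witnessing path avoids the vertices below u,
-- so collapsing it yields such a z.
wreach-dominated : ∀ {n} {G : Graph n} {O H : Digraph n} {r} → IsOrientation G O → Aug O (suc r) H →
                   ∀ ord {v u} → WReach G ord (suc r) v u →
                   Σ (Fin n) λ z → _≼_ ord u z × InClosedNbhd H z u × InClosedNbhd H z v
wreach-dominated _ _ _ (inj₁ refl) = _ , ≤-refl , inj₁ refl , inj₁ refl
wreach-dominated {r = r} orientation aug _ (inj₂ (_ , (x ∷ ys) , (starts , ends , linked , _) , len , above))
  with refl ← just-injective starts
  = collapse r aug (s≤s⁻¹ len) (list⇒walk x ys ends (Linked.map (λ {a} {b} → proj₁ orientation a b) linked) above)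

lemma6p7 : ∀ {n : ℕ} (G : Graph n) (r d : ℕ) (H : Digraph n) →
    0 < r → IsTFAug r G H → MaxInDegLE H d →
    WcolLE G r (2 * (suc d) ^ 2)
lemma6p7 {n} G (suc r) d H _ (O , orientation , aug) indeg = order , λ v → cover v , size v , covered v
  where
  ordered = degenerate-order H d indeg
  order = proj₁ ordered
  below : Fin n → List (Fin n)
  below z = z ∷ proj₁ (proj₂ ordered z)
  in-nbhd : Fin n → List (Fin n)
  in-nbhd v = v ∷ proj₁ (indeg v)
  cover : Fin n → List (Fin n)
  cover v = concatMap below (in-nbhd v)

  in-closed : ∀ {z v} → InClosedNbhd H z v → z ∈ in-nbhd v
  in-closed (inj₁ refl) = here refl
  in-closed (inj₂ a)    = there (proj₂ (proj₂ (indeg _)) _ a)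

  in-below : ∀ {u z} → _≼_ order u z → InClosedNbhd H z u → u ∈ below z
  in-below _   (inj₁ refl) = here refl
  in-below u≼z (inj₂ a)    =
    there (proj₂ (proj₂ (proj₂ ordered _)) _ (≼∧≢⇒≺ order u≼z (arc⇒≢ H a ∘ sym) , a))

  covered : ∀ v u → WReach G order (suc r) v u → u ∈ cover v
  covered v u reach with z , u≼z , z→u , z→v ← wreach-dominated {G = G} {O} orientation aug order reach =
    ∈-concatMap⁺ below {xs = in-nbhd v} (lose (in-closed z→v) (in-below u≼z z→u))

  -- d+1 lists of length at most d+1
  size : ∀ v → length (cover v) ≤ 2 * suc d ^ 2
  size v = ≤-trans (length-concatMap-≤ below (in-nbhd v) (λ z → s≤s (proj₁ (proj₂ (proj₂ ordered z)))))
                   (≤-trans (*-monoˡ-≤ (suc d) (s≤s (proj₁ (proj₂ (indeg v))))) (square≤2square (suc d)))
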